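{- Let $G=(V,E)$ be a graph of neighborhood diversity $k$ with neighborhood diversity classes $N_1,\dots,N_k$, and let $r$ be a non-negative integer. Then the number of $r$-equivalence classes of shapes of subsets of $V$ is at most $(2r+3)^k$.
   Context: The neighborhood diversity of $G$ is the minimum size of a partition of $V$ into classes such that any two vertices $v,v'$ in the same class satisfy $N(v)\setminus\{v'\}=N(v')\setminus\{v\}$; $N_1,\dots,N_k$ is such a partition. The shape of $X\subseteq V$ is $s=(s_1,\dots,s_k)$ with $s_i=|X\cap N_i|$, and its complementary shape is $\overline{s}=(|N_1|-s_1,\dots,|N_k|-s_k)$ (the shape of $V\setminus X$). Two shapes $s,t$ are $r$-equivalent if for every $i$, either $s_i=t_i$ or both $s_i,t_i>r$, and the same condition holds for the complementary shapes $\overline{s},\overline{t}$. -}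

module Defs where

open import Data.Nat using (ℕ; _<_; _∸_)
open import Data.Bool using (Bool; true; false; _∧_; not)
open import Data.Fin using (Fin; _≟_)
open import Data.Fin.Subset using (Subset; _∩_; ∣_∣)
open import Data.Vec using (tabulate)
open import Data.Product using (Σ; _×_)
open import Data.Sum using (_⊎_)
open import Function using (Surjective)
open import Relation.Nullary using (¬_)
open import Relation.Nullary.Decidable using (⌊_⌋)
open import Relation.Binary.PropositionalEquality using (_≡_; _≢_)

record Graph (n : ℕ) : Set where
  field
    adj   : Fin n → Fin n → Bool
    sym   : ∀ u v → adj u v ≡ adj v u
    irrefl : ∀ v → adj v v ≡ false

open Graph public

inNbhMinus : ∀ {n} → Graph n → Fin n → Fin n → Fin n → Bool
inNbhMinus G v v' w = adj G v w ∧ not ⌊ w ≟ v' ⌋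

SameType : ∀ {n} → Graph n → Fin n → Fin n → Set
SameType G v v' = ∀ w → inNbhMinus G v v' w ≡ inNbhMinus G v' v w

IsTypePartition : ∀ {n} → Graph n → (m : ℕ) → (Fin n → Fin m) → Set
IsTypePartition {n} G m cls =
  Surjective _≡_ _≡_ cls × (∀ v v' → cls v ≡ cls v' → SameType G v v')

-- cls is a neighborhood diversity partition: a type partition into k classes,
-- and no type partition into fewer classes exists (so nd(G) = k).
IsNDPartition : ∀ {n} → Graph n → (k : ℕ) → (Fin n → Fin k) → Set
IsNDPartition {n} G k cls =
  IsTypePartition G k cls ×
  (∀ m (c : Fin n → Fin m) → IsTypePartition G m c → ¬ (m < k))

classSet : ∀ {n k} → (Fin n → Fin k) → Fin k → Subset n
classSet cls i = tabulate (λ v → ⌊ cls v ≟ i ⌋)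

Shape : ℕ → Set
Shape k = Fin k → ℕ

shape : ∀ {n k} → (Fin n → Fin k) → Subset n → Shape k
shape cls X i = ∣ X ∩ classSet cls i ∣

coshape : ∀ {n k} → (Fin n → Fin k) → Shape k → Shape k
coshape cls s i = ∣ classSet cls i ∣ ∸ s i

REquiv : ∀ {n k} → (Fin n → Fin k) → ℕ → Shape k → Shape k → Set
REquiv cls r s t =
  (∀ i → s i ≡ t i ⊎ (r < s i × r < t i)) ×
  (∀ i → coshape cls s i ≡ coshape cls t i ⊎
         (r < coshape cls s i × r < coshape cls t i))

-- Two numbers r-agree iff their truncations s ⊓ (r + 1) coincide. In a class of
-- size m a shape entry s and its complement m ∸ s are captured by one entryCode with
-- 2r + 3 values: s itself when s ≤ r (which determines m ∸ s), and otherwise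
-- r + 1 plus the truncated complement. The k codes of a shape, read as the
-- digits of a number in base 2r + 3, identify its r-equivalence class.
module Submission where

open import Defs hiding (sym)
open import Data.Nat using (ℕ; suc; s≤s; _+_; _*_; _^_; _∸_; _⊓_; _≤_; _<_; _≤?_)
open import Data.Nat.Properties
open import Data.Nat.Tactic.RingSolver using (solve-∀)
open import Data.Fin using (Fin; toℕ; fromℕ<; funToFin; finToFun)
open import Data.Fin.Properties using (toℕ-fromℕ<; finToFun-funToFin)
open import Data.Fin.Subset using (Subset; ∣_∣)
open import Data.Product using (Σ; _×_; _,_; proj₁; proj₂)
open import Data.Sum using (_⊎_; inj₁; inj₂)
open import Data.Empty using (⊥-elim)
open import Function using (_∘_)
open import Relation.Nullary using (¬_; yes; no)
open import Relation.Binary.PropositionalEquality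
  using (_≡_; sym; trans; cong; subst)

RAgree : ℕ → ℕ → ℕ → Set
RAgree r s t = s ≡ t ⊎ (r < s × r < t)

⊓-suc-≤ : ∀ {r s} → s ≤ r → s ⊓ suc r ≡ s
⊓-suc-≤ s≤r = m≤n⇒m⊓n≡m (m≤n⇒m≤1+n s≤r)

⊓-suc-≰ : ∀ {r s} → ¬ s ≤ r → s ⊓ suc r ≡ suc r
⊓-suc-≰ s≰r = m≥n⇒m⊓n≡n (≰⇒> s≰r)

⊓-suc-≡⇒RAgree : ∀ {r s t} → s ⊓ suc r ≡ t ⊓ suc r → RAgree r s t
⊓-suc-≡⇒RAgree {r} {s} {t} eq with s ≤? r | t ≤? r
... | yes s≤r | yes t≤r = inj₁ (trans (sym (⊓-suc-≤ s≤r)) (trans eq (⊓-suc-≤ t≤r)))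
... | yes s≤r | no t≰r =
  ⊥-elim (1+n≰n (subst (_≤ r) (trans (sym (⊓-suc-≤ s≤r)) (trans eq (⊓-suc-≰ t≰r))) s≤r))
... | no s≰r | yes t≤r =
  ⊥-elim (1+n≰n (subst (_≤ r) (trans (sym (⊓-suc-≤ t≤r)) (trans (sym eq) (⊓-suc-≰ s≰r))) t≤r))
... | no s≰r | no t≰r = inj₂ (≰⇒> s≰r , ≰⇒> t≰r)

entryCode : (r m s : ℕ) → ℕ
entryCode r m s with s ≤? r
... | yes _ = s
... | no  _ = suc r + (m ∸ s) ⊓ suc r

entryCode≤ : ∀ r m s → entryCode r m s ≤ suc r + suc r
entryCode≤ r m s with s ≤? r
... | yes s≤r = ≤-trans s≤r (≤-trans (n≤1+n r) (m≤m+n (suc r) (suc r)))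
... | no  _   = +-monoʳ-≤ (suc r) (m⊓n≤n (m ∸ s) (suc r))

2r+3≡suc[1+r+1+r] : ∀ r → 2 * r + 3 ≡ suc (suc r + suc r)
2r+3≡suc[1+r+1+r] = solve-∀

entryCode< : ∀ r m s → entryCode r m s < 2 * r + 3
entryCode< r m s = ≤-trans (s≤s (entryCode≤ r m s)) (≤-reflexive (sym (2r+3≡suc[1+r+1+r] r)))

entryCode-injective : ∀ r m s t → entryCode r m s ≡ entryCode r m t →
  s ⊓ suc r ≡ t ⊓ suc r × (m ∸ s) ⊓ suc r ≡ (m ∸ t) ⊓ suc r
entryCode-injective r m s t eq with s ≤? r | t ≤? r
... | yes _ | yes _ = cong (_⊓ suc r) eq , cong (λ u → (m ∸ u) ⊓ suc r) eq
... | yes s≤r | no _ = ⊥-elim (<⇒≱ (m≤m+n (suc r) _) (subst (_≤ r) eq s≤r))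
... | no _ | yes t≤r = ⊥-elim (<⇒≱ (m≤m+n (suc r) _) (subst (_≤ r) (sym eq) t≤r))
... | no s≰r | no t≰r =
  trans (⊓-suc-≰ s≰r) (sym (⊓-suc-≰ t≰r)) , +-cancelˡ-≡ (suc r) _ _ eq

entryDigit : (r m s : ℕ) → Fin (2 * r + 3)
entryDigit r m s = fromℕ< (entryCode< r m s)

entryDigit-injective : ∀ r m s t → entryDigit r m s ≡ entryDigit r m t →
  RAgree r s t × RAgree r (m ∸ s) (m ∸ t)
entryDigit-injective r m s t eq
  with entryCode-injective r m s t
         (trans (sym (toℕ-fromℕ< _)) (trans (cong toℕ eq) (toℕ-fromℕ< _)))
... | agreeˢ , agreeᶜ = ⊓-suc-≡⇒RAgree agreeˢ , ⊓-suc-≡⇒RAgree agreeᶜ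

funToFin-injective : ∀ {k b} (f g : Fin k → Fin b) → funToFin f ≡ funToFin g → ∀ i → f i ≡ g i
funToFin-injective f g eq i =
  trans (sym (finToFun-funToFin f i))
        (trans (cong (λ x → finToFun x i) eq) (finToFun-funToFin g i))

proposition2 : ∀ {n k} (G : Graph n) (cls : Fin n → Fin k) → IsNDPartition G k cls →
    (r : ℕ) →
    Σ (Subset n → Fin ((2 * r + 3) ^ k)) λ f →
      ∀ X Y → f X ≡ f Y → REquiv cls r (shape cls X) (shape cls Y)
proposition2 {n} {k} _ cls _ r = funToFin ∘ digits , equivalent
  where
  digits : Subset n → Fin k → Fin (2 * r + 3)
  digits X i = entryDigit r ∣ classSet cls i ∣ (shape cls X i)

  equivalent : ∀ X Y → funToFin (digits X) ≡ funToFin (digits Y) →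
    REquiv cls r (shape cls X) (shape cls Y)
  equivalent X Y eq = proj₁ ∘ agree , proj₂ ∘ agree
    where
    agree : ∀ i → RAgree r (shape cls X i) (shape cls Y i)
                × RAgree r (coshape cls (shape cls X) i) (coshape cls (shape cls Y) i)
    agree i = entryDigit-injective r _ _ _ (funToFin-injective (digits X) (digits Y) eq i)
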